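{- Let $G$ be a graph, $R$ a connected subset of $V(G)$, $s_R\in R$, and $\mathcal{P}$ an $R$-shortest path collection. Then for all $u_1,u_2\in U_{\mathcal{P}}$, if $\widehat{\pi}[u_1]=\widehat{\pi}[u_2]$ then $\mathrm{prof}_{R,s_R}(u_1)=\mathrm{prof}_{R,s_R}(u_2)$.
   Context: Graphs are unweighted and undirected; $|Q|$ denotes the number of edges of a path, $\mathrm{dist}$ the shortest-path distance, $\mathrm{dist}(v,R)=\min_{y\in R}\mathrm{dist}(v,y)$, $P[a,b]$ the subpath of $P$ between $a,b$. $R$ is connected if $G[R]$ is. The distance profile of $u$ to $R$ relative to $s_R$ is $\mathrm{prof}_{R,s_R}(u)\colon R\to\mathbb{Z}$, $s\mapsto\mathrm{dist}(u,s)-\mathrm{dist}(u,s_R)$. An $R$-shortest path collection is a collection $\mathcal{P}$ of paths such that each $P\in\mathcal{P}$ is a path from some $v^P\in V(G)$ to a vertex $x^P\in R$ with $|P|=\mathrm{dist}(v^P,R)$ (so $x^P$ is its only vertex in $R$), and $R\subseteq\bigcup_{P\in\mathcal{P}}V(P)$. For $P\in\mathcal{P}$ order $V(P)$ by $v\le_P u$ iff $u\in V(P[v,x^P])$; a vertex $v\in V(P)$ is a milestone of $P$ if $v=x^P$ or $\mathrm{prof}_{R,x^P}(v)\ne\mathrm{prof}_{R,x^P}(u)$ where $u$ is the successor of $v$ in $\le_P$. Let $H_{\mathcal{P}}$ be the union of the paths of $\mathcal{P}$. A vertex is an anchor vertex if it has degree more than two in $H_{\mathcal{P}}$ or is a milestone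 of some $P\in\mathcal{P}$; $A_R(\mathcal{P})$ is the set of anchors. For $P\in\mathcal{P}$ and an anchor $w\in V(P)$, the prefix of $w$ in $P$ is the vertex set of the maximal subpath $Q$ of $P[v^P,w]$ such that $w$ is the only anchor vertex of $P$ in $Q$; $\mathrm{tail}(w)$ is the union of the prefixes of $w$ over all $P\in\mathcal{P}$ containing $w$. Let $U_{\mathcal{P}}=V(G)\setminus\bigcup_{P\in\mathcal{P}}V(P)$. For $u\in U_{\mathcal{P}}$ and $w\in A_R(\mathcal{P})$, $\widehat{\mathrm{dist}}(u,w)=\min\{|Q_{u,z}|+|P[z,w]|\}$ over all $P\in\mathcal{P}$ with $w\in V(P)$ and $z$ in the prefix of $w$ in $P$, where $Q_{u,z}$ is a minimum-length $u$–$z$ path among those whose internal vertices all lie in $U_{\mathcal{P}}$; if no such path exists for any $z\in V(\mathrm{tail}(w))$ then $\widehat{\mathrm{dist}}(u,w)=\infty$. Define $\pi[u](w)=\widehat{\mathrm{dist}}(u,w)+\mathrm{dist}(w,R)-\mathrm{dist}(u,R)$ and $\widehat{\pi}[u](w)=\min\{\pi[u](w),|R|+1\}$, as functions on $A_R(\mathcal{P})$. -}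

module Defs where

open import Data.Nat using (ℕ; zero; suc; _+_; _∸_; _≤_; _<_)
open import Data.Bool using (Bool; true; false; _∧_; _∨_; not; if_then_else_)
open import Data.Fin using (Fin; toℕ; fromℕ) renaming (_≟_ to _≟ᶠ_)
open import Data.Fin.Subset using (Subset; ∣_∣)
open import Data.Vec using (lookup)
open import Data.List using (List; allFin)
open import Data.Bool.ListAction using (any)
open import Data.List.Membership.Propositional using (_∈_)
open import Data.Integer using (ℤ; +_; _-_) renaming (_⊓_ to minℤ)
open import Data.Product using (Σ; ∃; ∃-syntax; _×_; _,_)
open import Data.Sum using (_⊎_)
open import Relation.Nullary using (¬_; ⌊_⌋)
open import Relation.Binary.PropositionalEquality using (_≡_; _≢_)

record Graph : Set where
  field
    n          : ℕ
    adj        : Fin n → Fin n → Bool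
    adj-sym    : ∀ u v → adj u v ≡ adj v u
    adj-irrefl : ∀ u → adj u u ≡ false

data ℕ∞ : Set where
  fin : ℕ → ℕ∞
  ∞   : ℕ∞

_+∞_ : ℕ∞ → ℕ∞ → ℕ∞
fin a +∞ fin b = fin (a + b)
_     +∞ _     = ∞

min∞ : ℕ∞ → ℕ∞ → ℕ∞
min∞ ∞ y = y
min∞ x ∞ = x
min∞ (fin a) (fin b) = fin (Data.Nat._⊓_ a b)

data _≤∞_ : ℕ∞ → ℕ∞ → Set where
  fin≤fin : ∀ {a b} → a ≤ b → fin a ≤∞ fin b
  _≤∞∞    : ∀ x → x ≤∞ ∞

suc∞ : ℕ∞ → ℕ∞
suc∞ (fin a) = fin (suc a)
suc∞ ∞ = ∞

least : (ℕ → Bool) → ℕ → ℕ∞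
least p zero    = ∞
least p (suc m) = if p 0 then fin 0 else suc∞ (least (λ k → p (suc k)) m)

-- difference of two distances as an integer.  Only ever applied to finite
-- values under the standing hypotheses of the lemma (G connected); the
-- ∞ cases are junk values.
_⊖∞_ : ℕ∞ → ℕ∞ → ℤ
fin a ⊖∞ fin b = (+ a) - (+ b)
_     ⊖∞ _     = + 0

-- "d is the minimum of the set {c | C c}" with min ∅ = ∞
IsMinOf : (ℕ∞ → Set) → ℕ∞ → Set
IsMinOf C d = (∀ c → C c → d ≤∞ c) × (d ≡ ∞ ⊎ C d)

-- Paths, given by their vertex sequence v^P = vtx 0, …, x^P = vtx len.

module _ {n : ℕ} where

  record Path : Set where
    field
      len : ℕ                    -- |P|, the number of edges
      vtx : Fin (suc len) → Fin n

  open Path public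

  startP : Path → Fin n
  startP P = vtx P Fin.zero

  endP : Path → Fin n
  endP P = vtx P (fromℕ (len P))

  OnPath : Path → Fin n → Set
  OnPath P v = ∃[ i ] vtx P i ≡ v

  _∈R_ : Fin n → Subset n → Set
  v ∈R R = lookup R v ≡ true

module _ (G : Graph) where
  open Graph G

  private
    V = Fin n
    eqb : V → V → Bool
    eqb u v = ⌊ u ≟ᶠ v ⌋
    anyV : (V → Bool) → Bool
    anyV f = any f (allFin n)

  -- walkThrough S u v k = true iff there is a walk u = a₀, a₁, …, a_k = v
  -- in G whose internal vertices a₁ … a_{k-1} all satisfy S.
  walkThrough : (V → Bool) → V → V → ℕ → Bool
  walkThrough S u v zero    = eqb u v
  walkThrough S u v (suc k) =
    anyV (λ w → adj u w ∧ (isZero k ∨ S w) ∧ walkThrough S w v k)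
    where
      isZero : ℕ → Bool
      isZero zero    = true
      isZero (suc _) = false

  -- length of a shortest u–v path all of whose internal vertices satisfy S
  -- (∞ if none).  A shortest such walk is a path, so has < n edges.
  distThrough : (V → Bool) → V → V → ℕ∞
  distThrough S u v = least (walkThrough S u v) n

  dist : V → V → ℕ∞
  dist = distThrough (λ _ → true)

  IsConnected : Set
  IsConnected = ∀ u v → dist u v ≢ ∞

  distSet : V → Subset n → ℕ∞
  distSet v R = Data.List.foldr
    (λ y acc → if lookup R y then min∞ (dist v y) acc else acc) ∞ (allFin n)

  ConnectedSet : Subset n → Set
  ConnectedSet R = ∀ a b → a ∈R R → b ∈R R → distThrough (lookup R) a b ≢ ∞

  IsPath : Path → Set
  IsPath P = (∀ (i j : Fin (suc (len P))) → toℕ j ≡ suc (toℕ i) →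
                adj (vtx P i) (vtx P j) ≡ true)
           × (∀ (i j : Fin (suc (len P))) → vtx P i ≡ vtx P j → i ≡ j)

  prof : Subset n → V → V → V → ℤ
  prof R x u s = dist u s ⊖∞ dist u x

  ProfEq : Subset n → V → V → V → Set
  ProfEq R x u u' = ∀ s → s ∈R R → prof R x u s ≡ prof R x u' s

  IsRShortestPathCollection : Subset n → List Path → Set
  IsRShortestPathCollection R 𝒫 =
      (∀ P → P ∈ 𝒫 → IsPath P × endP P ∈R R × fin (len P) ≡ distSet (startP P) R)
    × (∀ r → r ∈R R → ∃[ P ] (P ∈ 𝒫 × OnPath P r))

  IsMilestone : Subset n → Path → V → Set
  IsMilestone R P v = ∃[ i ] (vtx P i ≡ v ×
      (toℕ i ≡ len P
       ⊎ ∃[ j ] (toℕ j ≡ suc (toℕ i) × ¬ ProfEq R (endP P) v (vtx P j))))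

  HEdge : List Path → V → V → Set
  HEdge 𝒫 a b = ∃[ P ] (P ∈ 𝒫 × ∃[ i ] ∃[ j ] (toℕ j ≡ suc (toℕ i) ×
      ((vtx P i ≡ a × vtx P j ≡ b) ⊎ (vtx P i ≡ b × vtx P j ≡ a))))

  DegGt2 : List Path → V → Set
  DegGt2 𝒫 a = ∃[ b₁ ] ∃[ b₂ ] ∃[ b₃ ]
    (b₁ ≢ b₂ × b₁ ≢ b₃ × b₂ ≢ b₃ × HEdge 𝒫 a b₁ × HEdge 𝒫 a b₂ × HEdge 𝒫 a b₃)

  IsAnchor : Subset n → List Path → V → Set
  IsAnchor R 𝒫 w = DegGt2 𝒫 w ⊎ ∃[ P ] (P ∈ 𝒫 × IsMilestone R P w)

  inU : List Path → V → Bool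
  inU 𝒫 u = not (any (λ P → any (λ i → eqb (vtx P i) u) (allFin (suc (len P)))) 𝒫)

  InPrefix : Subset n → List Path → (P : Path) → (i j : Fin (suc (len P))) → Set
  InPrefix R 𝒫 P i j = toℕ i ≤ toℕ j ×
    (∀ k → toℕ i ≤ toℕ k → toℕ k < toℕ j → ¬ IsAnchor R 𝒫 (vtx P k))

  -- c is one of the values |Q_{u,z}| + |P[z,w]| in the definition of dist^(u,w)
  DistHatCandidate : Subset n → List Path → V → V → ℕ∞ → Set
  DistHatCandidate R 𝒫 u w c = ∃[ P ] (P ∈ 𝒫 × ∃[ i ] ∃[ j ]
    (vtx P j ≡ w × InPrefix R 𝒫 P i j ×
     c ≡ distThrough (inU 𝒫) u (vtx P i) +∞ fin (toℕ j ∸ toℕ i)))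

  IsDistHat : Subset n → List Path → V → V → ℕ∞ → Set
  IsDistHat R 𝒫 u w d = IsMinOf (DistHatCandidate R 𝒫 u w) d

  -- π^[u](w) = min(dist^(u,w) + dist(w,R) - dist(u,R), |R| + 1), computed
  -- from d = dist^(u,w).  (The last clause is only reached when d = ∞, or
  -- in junk cases excluded by connectivity of G.)
  piHat : Subset n → V → V → ℕ∞ → ℤ
  piHat R u w d with d | distSet w R | distSet u R
  ... | fin a | fin b | fin c = minℤ ((+ a) Data.Integer.+ (+ b) - (+ c)) (+ suc ∣ R ∣)
  ... | _     | _     | _     = + suc ∣ R ∣

  PiHatEq : Subset n → List Path → V → V → Set
  PiHatEq R 𝒫 u₁ u₂ = ∀ w → IsAnchor R 𝒫 w → ∀ d₁ d₂ →
    IsDistHat R 𝒫 u₁ w d₁ → IsDistHat R 𝒫 u₂ w d₂ → piHat R u₁ w d₁ ≡ piHat R u₂ w d₂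

{-# OPTIONS --safe #-}
-- Fix s ∈ R. A shortest route from u ∈ U to s leaves U at a vertex z of some P ∈ 𝒫. Between z
-- and the next anchor w on P (towards x^P) there is no milestone, so z and w have the same
-- profile towards x^P; as z is farther from x^P by exactly the number of steps, it is farther
-- from s by the same amount. Hence dist^(u,w) + dist(w,s) ≤ dist(u,s), so π[u](w) ≤ |R|
-- (R has diameter at most |R|) and π^[u](w) is not truncated. Every dist^-candidate is the
-- length of a walk, so for the other vertex u′ we get dist(u′,s) ≤ dist^(u′,w) + dist(w,s);
-- with π^[u′](w) = π^[u](w) this gives dist(u′,s) − dist(u′,R) ≤ dist(u,s) − dist(u,R).
-- By symmetry these offsets agree for all s ∈ R, and a profile is a difference of offsets.
module Submission where

open import Defs
open import Level using (0ℓ)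
open import Function using (_∘_; Equivalence)
open import Effect.Monad using (RawMonad)
open import Data.Nat using (ℕ; zero; suc; _+_; _∸_; _≤_; _<_; z≤n; s≤s; z<s)
open import Data.Nat.Properties
open import Data.Nat.Induction using (<-rec)
open import Data.Bool using (Bool; true; false; _∧_; not; T; if_then_else_)
open import Data.Bool.Properties using (T-≡; not-injective)
open import Data.Fin using (Fin; toℕ; fromℕ<) renaming (_≟_ to _≟ᶠ_)
open import Data.Fin.Properties using (toℕ-injective; toℕ-fromℕ<; toℕ-fromℕ; toℕ≤pred[n]; ≤fromℕ)
open import Data.Fin.Subset using (Subset; ∣_∣; ⊤; ⁅_⁆) renaming (_∈_ to _∈ˢ_; _-_ to _∖_)
open import Data.Fin.Subset.Properties using (x∈p⇒∣p-x∣<∣p∣; x∈p∧x∉q⇒x∈p─q; x≢y⇒x∉⁅y⁆; ∣⊤∣≡n; ∈⊤)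
open import Data.Vec using (lookup)
open import Data.Vec.Properties using (lookup⇒[]=; []=⇒lookup)
open import Data.List using (List; []; _∷_; length; allFin; foldr)
open import Data.List.Membership.Propositional using (_∈_; lose; find)
open import Data.List.Membership.Propositional.Properties using (∈-allFin)
open import Data.List.Relation.Unary.Any using (here; there; satisfied)
open import Data.List.Relation.Unary.Any.Properties using (any⁺; any⁻)
open import Data.List.Relation.Unary.All using (All; []; _∷_; tabulate)
open import Data.List.Relation.Unary.All.Properties using (¬Any⇒All¬)
open import Data.List.Relation.Unary.AllPairs using ([]; _∷_)
open import Data.List.Relation.Unary.Unique.Propositional using (Unique)
open import Data.Product using (Σ; ∃; ∃-syntax; _×_; _,_; proj₁; proj₂)
open import Data.Sum using (inj₁; inj₂)
open import Data.Unit using (tt) renaming (⊤ to Unit)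
open import Relation.Nullary using (¬_; yes; no; contradiction)
open import Relation.Nullary.Negation using (¬¬-Monad)
open import Relation.Nullary.Decidable using (decidable-stable; ¬¬-excluded-middle; toWitness; fromWitness)
open import Relation.Binary.PropositionalEquality
open import Data.Integer as ℤ using (ℤ; +_; _-_; _⊓_; +≤+; +<+)
import Data.Integer.Properties as ℤₚ
open import Data.Integer.Tactic.RingSolver using (solve-∀)

open import Algebra.Properties.CommutativeSemigroup +-commutativeSemigroup using (xy∙z≈xz∙y)

open RawMonad (¬¬-Monad {0ℓ}) using (_>>=_; pure)

fin-injective : ∀ {a b} → fin a ≡ fin b → a ≡ b
fin-injective refl = refl

finite : ∀ d → d ≢ ∞ → ∃[ a ] d ≡ fin a
finite (fin a) _   = a , refl
finite ∞       d≢∞ = contradiction refl d≢∞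

fin≢∞ : ∀ {a} → fin a ≢ ∞
fin≢∞ ()

fin≡+∞fin⇒ : ∀ {c k} d → fin c ≡ d +∞ fin k → ∃[ q ] (d ≡ fin q × c ≡ q + k)
fin≡+∞fin⇒ (fin q) refl = q , refl , refl

least-sound : ∀ p m {k} → least p m ≡ fin k → p k ≡ true
least-sound p (suc m) eq with p 0 in p0 | least (p ∘ suc) m in rest
least-sound p (suc m) refl | true  | _     = p0
least-sound p (suc m) refl | false | fin j = least-sound (p ∘ suc) m rest

least-complete : ∀ p m {k} → p k ≡ true → k < m → ∃[ j ] (j ≤ k × least p m ≡ fin j)
least-complete p (suc m) {k} pk k<m with p 0 in p0
... | true = 0 , z≤n , refl
least-complete p (suc m) {zero} pk _ | false = contradiction (trans (sym p0) pk) λ ()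
least-complete p (suc m) {suc k} pk (s≤s k<m) | false with least-complete (p ∘ suc) m pk k<m
... | j , j≤k , eq rewrite eq = suc j , s≤s j≤k , refl

¬¬-∃-IsMinOf : (C : ℕ∞ → Set) → ¬ ¬ ∃ (IsMinOf C)
¬¬-∃-IsMinOf C = ¬¬-excluded-middle >>= λ where
    (no ∄C)         → pure (∞ , (λ { (fin k) Ck → contradiction (k , Ck) ∄C ; ∞ _ → ∞ ≤∞∞ }) , inj₁ refl)
    (yes (k , Ck)) → <-rec (λ k → C (fin k) → ¬ ¬ ∃ (IsMinOf C)) lowest k Ck
  where
  lowest : ∀ k → (∀ {j} → j < k → C (fin j) → ¬ ¬ ∃ (IsMinOf C)) → C (fin k) → ¬ ¬ ∃ (IsMinOf C)
  lowest k below Ck = ¬¬-excluded-middle {A = ∃[ j ] (j < k × C (fin j))} >>= λ where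
      (yes (j , j<k , Cj)) → below j<k Cj
      (no ∄j)              → pure (fin k , minimal ∄j , inj₂ Ck)
    where
    minimal : ¬ (∃[ j ] (j < k × C (fin j))) → ∀ c → C c → fin k ≤∞ c
    minimal ∄j (fin j) Cj = fin≤fin (≮⇒≥ λ j<k → ∄j (j , j<k , Cj))
    minimal ∄j ∞       _  = fin k ≤∞∞

IsMinOf-fin : ∀ {C d c} → IsMinOf C d → C (fin c) → ∃[ e ] (d ≡ fin e × e ≤ c)
IsMinOf-fin {d = d} (lower , _) Cc with d | lower _ Cc
... | fin e | fin≤fin e≤c = e , refl , e≤c


+m-+n≡+o-+p⇒m+p≡o+n : ∀ m n o p → + m - + n ≡ + o - + p → m + p ≡ o + n
+m-+n≡+o-+p⇒m+p≡o+n m n o p eq = ℤₚ.+-injective (begin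
    + m ℤ.+ + p                     ≡⟨ shift (+ m) (+ n) (+ p) ⟩
    (+ m - + n) ℤ.+ (+ n ℤ.+ + p)   ≡⟨ cong (λ t → t ℤ.+ (+ n ℤ.+ + p)) eq ⟩
    (+ o - + p) ℤ.+ (+ n ℤ.+ + p)   ≡⟨ unshift (+ o) (+ n) (+ p) ⟩
    + o ℤ.+ + n                     ∎)
  where
  open ≡-Reasoning
  shift : ∀ (x y z : ℤ) → x ℤ.+ z ≡ (x - y) ℤ.+ (y ℤ.+ z)
  shift = solve-∀
  unshift : ∀ (x y z : ℤ) → (x - z) ℤ.+ (y ℤ.+ z) ≡ x ℤ.+ y
  unshift = solve-∀

m+p≤o+n⇒+m-+n≤+o-+p : ∀ m n o p → m + p ≤ o + n → + m - + n ℤ.≤ + o - + p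
m+p≤o+n⇒+m-+n≤+o-+p m n o p le = begin
    + m - + n                       ≡⟨ shift (+ m) (+ n) (+ p) ⟩
    (+ m ℤ.+ + p) - (+ n ℤ.+ + p)   ≤⟨ ℤₚ.+-monoˡ-≤ (ℤ.- (+ n ℤ.+ + p)) (+≤+ le) ⟩
    (+ o ℤ.+ + n) - (+ n ℤ.+ + p)   ≡⟨ unshift (+ o) (+ n) (+ p) ⟩
    + o - + p                       ∎
  where
  open ℤₚ.≤-Reasoning
  shift : ∀ (x y z : ℤ) → x - y ≡ (x ℤ.+ z) - (y ℤ.+ z)
  shift = solve-∀
  unshift : ∀ (x y z : ℤ) → (x ℤ.+ y) - (y ℤ.+ z) ≡ x - z
  unshift = solve-∀

m≤n+o⇒+m-+n≤+o : ∀ m n o → m ≤ n + o → + m - + n ℤ.≤ + o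
m≤n+o⇒+m-+n≤+o m n o le =
  ℤₚ.≤-trans (ℤₚ.+-monoˡ-≤ (ℤ.- + n) (+≤+ le)) (ℤₚ.≤-reflexive (cancel (+ n) (+ o)))
  where
  cancel : ∀ (x y : ℤ) → (x ℤ.+ y) - x ≡ y
  cancel = solve-∀

i⊓j≡k∧k<j⇒i≡k : ∀ {i j k} → i ⊓ j ≡ k → k ℤ.< j → i ≡ k
i⊓j≡k∧k<j⇒i≡k {i} {j} eq k<j with ℤₚ.⊓-sel i j
... | inj₁ i⊓j≡i = trans (sym i⊓j≡i) eq
... | inj₂ i⊓j≡j = contradiction (trans (sym eq) i⊓j≡j) (ℤₚ.<⇒≢ k<j)

i-j≡[i-k]-[j-k] : ∀ i j k → i - j ≡ (i - k) - (j - k)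
i-j≡[i-k]-[j-k] = solve-∀

∈ᴿ⇒∈ : ∀ {n} {R : Subset n} {x} → x ∈R R → x ∈ˢ R
∈ᴿ⇒∈ {R = R} {x} = lookup⇒[]= x R

unique⇒length≤∣p∣ : ∀ {n} (R : Subset n) (xs : List (Fin n)) → Unique xs →
  All (_∈R R) xs → length xs ≤ ∣ R ∣
unique⇒length≤∣p∣ R []       _             _          = z≤n
unique⇒length≤∣p∣ R (x ∷ xs) (x∉xs ∷ uniq) (x∈R ∷ xs⊆R) =
  ≤-trans (s≤s (unique⇒length≤∣p∣ (R ∖ x) xs uniq (remove x∉xs xs⊆R)))
          (x∈p⇒∣p-x∣<∣p∣ {p = R} (∈ᴿ⇒∈ {R = R} x∈R))
  where
  remove : ∀ {ys} → All (x ≢_) ys → All (_∈R R) ys → All (_∈R (R ∖ x)) ys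
  remove []            []          = []
  remove (x≢y ∷ x≢ys) (y∈R ∷ ys⊆R) =
    []=⇒lookup (x∈p∧x∉q⇒x∈p─q {p = R} {q = ⁅ x ⁆} (∈ᴿ⇒∈ {R = R} y∈R) (x≢y⇒x∉⁅y⁆ (x≢y ∘ sym)))
    ∷ remove x≢ys ys⊆R

module _ {n} (R : Subset n) (f : Fin n → ℕ∞) (g : Fin n → ℕ) (f≡g : ∀ y → f y ≡ fin (g y)) where

  minOver : List (Fin n) → ℕ∞
  minOver = foldr (λ y acc → if lookup R y then min∞ (f y) acc else acc) ∞

  minOver-≤ : ∀ {y} xs → y ∈ xs → y ∈R R → ∃[ m ] (minOver xs ≡ fin m × m ≤ g y)
  minOver-≤ {y} (_ ∷ xs) (here refl) y∈R rewrite y∈R | f≡g y with minOver xs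
  ... | fin m = _ , refl , m⊓n≤m _ _
  ... | ∞     = _ , refl , ≤-refl
  minOver-≤ (x ∷ xs) (there y∈xs) y∈R with m , eq , m≤ ← minOver-≤ xs y∈xs y∈R | lookup R x
  ... | false = m , eq , m≤
  ... | true rewrite eq | f≡g x = _ , refl , ≤-trans (m⊓n≤n _ _) m≤

  minOver-attained : ∀ xs {m} → minOver xs ≡ fin m → ∃[ y ] (y ∈R R × g y ≡ m)
  minOver-attained (x ∷ xs) eq with lookup R x in x∈R
  ... | false = minOver-attained xs eq
  ... | true with minOver xs in rest
  ...   | ∞ rewrite f≡g x with refl ← eq = x , x∈R , refl
  ...   | fin m rewrite f≡g x with refl ← eq with ⊓-sel (g x) m
  ...     | inj₁ ⊓≡x = x , x∈R , sym ⊓≡x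
  ...     | inj₂ ⊓≡m with y , y∈R , gy≡m ← minOver-attained xs rest = y , y∈R , trans gy≡m (sym ⊓≡m)

next : ∀ {m} (i : Fin (suc m)) → toℕ i < m → Fin (suc m)
next i i<m = fromℕ< (s≤s i<m)

toℕ-next : ∀ {m} (i : Fin (suc m)) (i<m : toℕ i < m) → toℕ (next i i<m) ≡ suc (toℕ i)
toℕ-next i i<m = toℕ-fromℕ< (s≤s i<m)

T-∧₃ : ∀ {a b c} → T (a ∧ b ∧ c) → a ≡ true × b ≡ true × c ≡ true
T-∧₃ {true} {true} {true} _ = refl , refl , refl

∧₃-T : ∀ {a b c} → a ≡ true → b ≡ true → c ≡ true → T (a ∧ b ∧ c)
∧₃-T refl refl refl = tt

module Walks (G : Graph) where
  open Graph G
  open import Data.List.Membership.DecPropositional (_≟ᶠ_ {n}) using (_∈?_)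

  anywhere : Fin n → Bool
  anywhere _ = true

  Interior : (Fin n → Bool) → ℕ → Fin n → Set
  Interior S zero    _ = Unit
  Interior S (suc _) w = S w ≡ true

  data Walk (S : Fin n → Bool) : Fin n → Fin n → ℕ → Set where
    []   : ∀ {u} → Walk S u u 0
    step : ∀ {u w v k} → adj u w ≡ true → Interior S k w → Walk S w v k → Walk S u v (suc k)

  walkThrough⇒Walk : ∀ {S u v} k → walkThrough G S u v k ≡ true → Walk S u v k
  walkThrough⇒Walk {S} {u} zero eq = subst (λ v → Walk S u v 0) (toWitness (Equivalence.from T-≡ eq)) []
  walkThrough⇒Walk (suc zero) eq =
    let _ , t = satisfied (any⁻ _ (allFin n) (Equivalence.from T-≡ eq))
        a , _ , p = T-∧₃ t
    in step a tt (walkThrough⇒Walk zero p)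
  walkThrough⇒Walk (suc (suc k)) eq =
    let _ , t = satisfied (any⁻ _ (allFin n) (Equivalence.from T-≡ eq))
        a , i , p = T-∧₃ t
    in step a i (walkThrough⇒Walk (suc k) p)

  Walk⇒walkThrough : ∀ {S u v k} → Walk S u v k → walkThrough G S u v k ≡ true
  Walk⇒walkThrough [] = Equivalence.to T-≡ (fromWitness refl)
  Walk⇒walkThrough (step {w = w} {k = zero} a _ p) =
    Equivalence.to T-≡ (any⁺ _ (lose (∈-allFin w) (∧₃-T a refl (Walk⇒walkThrough p))))
  Walk⇒walkThrough (step {w = w} {k = suc _} a i p) =
    Equivalence.to T-≡ (any⁺ _ (lose (∈-allFin w) (∧₃-T a i (Walk⇒walkThrough p))))

  vertices : ∀ {S u v k} → Walk S u v k → List (Fin n)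
  vertices {u = u} []           = u ∷ []
  vertices {u = u} (step _ _ p) = u ∷ vertices p

  length-vertices : ∀ {S u v k} (p : Walk S u v k) → length (vertices p) ≡ suc k
  length-vertices []           = refl
  length-vertices (step _ _ p) = cong suc (length-vertices p)

  Interior-mono : ∀ {S k k′ w} → k′ ≤ k → Interior S k w → Interior S k′ w
  Interior-mono {k′ = zero}              z≤n     _ = tt
  Interior-mono {k = suc _} {k′ = suc _} (s≤s _) i = i

  suffixFrom : ∀ {S u v k x} (p : Walk S u v k) → x ∈ vertices p →
    ∃[ k′ ] (k′ ≤ k × Σ (Walk S x v k′) λ p′ → Unique (vertices p) → Unique (vertices p′))
  suffixFrom []           (here refl) = 0 , z≤n , [] , λ uniq → uniq
  suffixFrom (step a i p) (here refl) = _ , ≤-refl , step a i p , λ uniq → uniq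
  suffixFrom (step a i p) (there x∈p) with k′ , k′≤k , p′ , uniq⇒ ← suffixFrom p x∈p =
    k′ , m≤n⇒m≤1+n k′≤k , p′ , λ { (_ ∷ uniq) → uniq⇒ uniq }

  shortcut : ∀ {S u v k} → Walk S u v k → ∃[ k′ ] (k′ ≤ k × Σ (Walk S u v k′) (Unique ∘ vertices))
  shortcut []                      = 0 , z≤n , [] , [] ∷ []
  shortcut {u = u} (step a i p) with k′ , k′≤k , p′ , uniq ← shortcut p | u ∈? vertices p′
  ... | yes u∈p′ with k″ , k″≤k′ , p″ , uniq⇒ ← suffixFrom p′ u∈p′ =
    k″ , m≤n⇒m≤1+n (≤-trans k″≤k′ k′≤k) , p″ , uniq⇒ uniq
  ... | no  u∉p′ = suc k′ , s≤s k′≤k , step a (Interior-mono k′≤k i) p′ , ¬Any⇒All¬ _ u∉p′ ∷ uniq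

  All-vertices : ∀ {S u v k} (p : Walk S u v k) → S u ≡ true → S v ≡ true →
    All (λ x → S x ≡ true) (vertices p)
  All-vertices []                         Su _  = Su ∷ []
  All-vertices (step _ _ [])              Su Sv = Su ∷ Sv ∷ []
  All-vertices (step _ Sw p@(step _ _ _)) Su Sv = Su ∷ All-vertices p Sw Sv

  unique⇒length<n : ∀ {S u v k} (p : Walk S u v k) → Unique (vertices p) → k < n
  unique⇒length<n p uniq = subst₂ _≤_ (length-vertices p) (∣⊤∣≡n n)
    (unique⇒length≤∣p∣ ⊤ (vertices p) uniq (tabulate λ {x} _ → []=⇒lookup (∈⊤ {x = x})))

  distThrough-≤ : ∀ {S u v k} → Walk S u v k → ∃[ q ] (q ≤ k × distThrough G S u v ≡ fin q)
  distThrough-≤ {S} {u} {v} p with k′ , k′≤k , p′ , uniq ← shortcut p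
    with q , q≤k′ , eq ← least-complete (walkThrough G S u v) n (Walk⇒walkThrough p′) (unique⇒length<n p′ uniq) =
    q , ≤-trans q≤k′ k′≤k , eq

  distThrough⇒Walk : ∀ {S u v q} → distThrough G S u v ≡ fin q → Walk S u v q
  distThrough⇒Walk {S} {u} {v} {q} eq = walkThrough⇒Walk q (least-sound (walkThrough G S u v) n eq)

  Interior-anywhere : ∀ k w → Interior anywhere k w
  Interior-anywhere zero    _ = tt
  Interior-anywhere (suc _) _ = refl

  forget : ∀ {S u v k} → Walk S u v k → Walk anywhere u v k
  forget []                           = []
  forget (step {w = w} {k = k} a _ p) = step a (Interior-anywhere k w) (forget p)

  _++_ : ∀ {u w v k l} → Walk anywhere u w k → Walk anywhere w v l → Walk anywhere u v (k + l)
  []                         ++ q = q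
  step {w = w} {k = k} a _ p ++ q = step a (Interior-anywhere (k + _) w) (p ++ q)

  pathWalk : ∀ {P} → IsPath G P → ∀ d (i j : Fin (suc (len P))) → toℕ i + d ≡ toℕ j →
    Walk anywhere (vtx P i) (vtx P j) d
  pathWalk {P} _ zero i j i+0≡j =
    subst (λ j → Walk anywhere (vtx P i) (vtx P j) 0) (toℕ-injective (trans (sym (+-identityʳ _)) i+0≡j)) []
  pathWalk {P} isP (suc d) i j i+d≡j =
    step (proj₁ isP i i′ (toℕ-next i i<len)) (Interior-anywhere d _) (pathWalk isP d i′ j i′+d≡j)
    where
    i<len : toℕ i < len P
    i<len = <-≤-trans (subst (toℕ i <_) i+d≡j (m<m+n (toℕ i) z<s)) (toℕ≤pred[n] j)
    i′ = next i i<len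
    i′+d≡j : toℕ i′ + d ≡ toℕ j
    i′+d≡j = trans (cong (_+ d) (toℕ-next i i<len)) (trans (sym (+-suc (toℕ i) d)) i+d≡j)

  firstExit : ∀ {S u v l} → Walk anywhere u v l → S u ≡ true → S v ≡ false →
    ∃[ z ] ∃[ t ] ∃[ r ] (t + r ≡ l × S z ≡ false × Walk S u z t × Walk anywhere z v r)
  firstExit []  Su Sv = contradiction (trans (sym Su) Sv) λ ()
  firstExit {S} (step {w = w} {k = k} a _ p) Su Sv with S w in Sw
  ... | false = w , 1 , k , refl , Sw , step a tt [] , p
  ... | true with z , t , r , t+r≡k , Sz , to-z , from-z ← firstExit p Sw Sv =
    z , suc t , r , cong suc t+r≡k , Sz , step a (interior t) to-z , from-z
    where
    interior : ∀ t → Interior S t w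
    interior zero    = tt
    interior (suc _) = Sw

module Distances (G : Graph) (conn : IsConnected G) where
  open Graph G
  open Walks G

  D : Fin n → Fin n → ℕ
  D u v = proj₁ (finite (dist G u v) (conn u v))

  dist≡fin-D : ∀ u v → dist G u v ≡ fin (D u v)
  dist≡fin-D u v = proj₂ (finite (dist G u v) (conn u v))

  shortestWalk : ∀ u v → Walk anywhere u v (D u v)
  shortestWalk u v = distThrough⇒Walk (dist≡fin-D u v)

  D-≤-Walk : ∀ {S u v k} → Walk S u v k → D u v ≤ k
  D-≤-Walk {u = u} {v} {k} p with q , q≤k , eq ← distThrough-≤ (forget p) =
    subst (_≤ k) (fin-injective (trans (sym eq) (dist≡fin-D u v))) q≤k

  D-triangle : ∀ u w v → D u v ≤ D u w + D w v
  D-triangle u w v = D-≤-Walk (shortestWalk u w ++ shortestWalk w v)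

  D-along-path : ∀ {P} → IsPath G P → ∀ {i j : Fin (suc (len P))} → toℕ i ≤ toℕ j →
    D (vtx P i) (vtx P j) ≤ toℕ j ∸ toℕ i
  D-along-path isP {i} {j} i≤j = D-≤-Walk (pathWalk isP _ i j (m+[n∸m]≡n i≤j))

  -- distSet G v R unfolds to minOver R (dist G v) (allFin n).
  module DistanceToSet (R : Subset n) {r} (r∈R : r ∈R R) where

    distSet≢∞ : ∀ v → distSet G v R ≢ ∞
    distSet≢∞ v with _ , eq , _ ← minOver-≤ R (dist G v) (D v) (dist≡fin-D v) (allFin n) (∈-allFin r) r∈R =
      fin≢∞ ∘ trans (sym eq)

    DR : Fin n → ℕ
    DR v = proj₁ (finite (distSet G v R) (distSet≢∞ v))

    distSet≡fin-DR : ∀ v → distSet G v R ≡ fin (DR v)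
    distSet≡fin-DR v = proj₂ (finite (distSet G v R) (distSet≢∞ v))

    DR-≤ : ∀ v {y} → y ∈R R → DR v ≤ D v y
    DR-≤ v y∈R with m , eq , m≤ ← minOver-≤ R (dist G v) (D v) (dist≡fin-D v) (allFin n) (∈-allFin _) y∈R
      with refl ← trans (sym (distSet≡fin-DR v)) eq = m≤

    DR-attained : ∀ v → ∃[ y ] (y ∈R R × D v y ≡ DR v)
    DR-attained v = minOver-attained R (dist G v) (D v) (dist≡fin-D v) (allFin n) (distSet≡fin-DR v)

    D-≤-∣R∣ : ConnectedSet G R → ∀ {y s} → y ∈R R → s ∈R R → D y s ≤ ∣ R ∣
    D-≤-∣R∣ R-conn {y} {s} y∈R s∈R
      with q , eq ← finite (distThrough G (lookup R) y s) (R-conn y s y∈R s∈R)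
      with k , _ , p , uniq ← shortcut (distThrough⇒Walk {S = lookup R} eq) = begin
        D y s                  ≤⟨ D-≤-Walk p ⟩
        k                      <⟨ n<1+n k ⟩
        suc k                  ≡⟨ length-vertices p ⟨
        length (vertices p)    ≤⟨ unique⇒length≤∣p∣ R (vertices p) uniq (All-vertices p y∈R s∈R) ⟩
        ∣ R ∣                  ∎
      where open ≤-Reasoning

    D-≤-DR+∣R∣ : ConnectedSet G R → ∀ v {s} → s ∈R R → D v s ≤ DR v + ∣ R ∣
    D-≤-DR+∣R∣ R-conn v {s} s∈R with y , y∈R , Dvy≡DR ← DR-attained v = begin
      D v s          ≤⟨ D-triangle v y s ⟩
      D v y + D y s  ≤⟨ +-mono-≤ (≤-reflexive Dvy≡DR) (D-≤-∣R∣ R-conn y∈R s∈R) ⟩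
      DR v + ∣ R ∣   ∎
      where open ≤-Reasoning

module ShortestPathCollection (G : Graph) (conn : IsConnected G) (R : Subset (Graph.n G)) {r} (r∈R : r ∈R R)
                  (𝒫 : List (Path {Graph.n G})) (coll : IsRShortestPathCollection G R 𝒫) where
  open Graph G
  open Walks G
  open Distances G conn
  open DistanceToSet R r∈R

  isPath : ∀ {P} → P ∈ 𝒫 → IsPath G P
  isPath P∈𝒫 = proj₁ (proj₁ coll _ P∈𝒫)

  end∈R : ∀ {P} → P ∈ 𝒫 → endP P ∈R R
  end∈R P∈𝒫 = proj₁ (proj₂ (proj₁ coll _ P∈𝒫))

  len≡DR : ∀ {P} → P ∈ 𝒫 → len P ≡ DR (startP P)
  len≡DR P∈𝒫 = fin-injective (trans (proj₂ (proj₂ (proj₁ coll _ P∈𝒫))) (distSet≡fin-DR _))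

  U : Fin n → Bool
  U = inU G 𝒫

  Anchor : Fin n → Set
  Anchor = IsAnchor G R 𝒫

  onPath⇒∉U : ∀ {P} → P ∈ 𝒫 → ∀ i → U (vtx P i) ≡ false
  onPath⇒∉U P∈𝒫 i =
    cong not (Equivalence.to T-≡ (any⁺ _ (lose P∈𝒫 (any⁺ _ (lose (∈-allFin i) (fromWitness refl))))))

  ∉U⇒onPath : ∀ {v} → U v ≡ false → ∃[ P ] (P ∈ 𝒫 × ∃[ i ] vtx P i ≡ v)
  ∉U⇒onPath v∉U =
    let P , P∈𝒫 , t = find (any⁻ _ 𝒫 (Equivalence.from T-≡ (not-injective v∉U)))
        i , t′      = satisfied (any⁻ _ (allFin _) t)
    in P , P∈𝒫 , i , toWitness t′

  R⇒∉U : ∀ {s} → s ∈R R → U s ≡ false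
  R⇒∉U s∈R with P , P∈𝒫 , i , refl ← proj₂ coll _ s∈R = onPath⇒∉U P∈𝒫 i

  D-to-end : ∀ {P} → P ∈ 𝒫 → ∀ i → D (vtx P i) (endP P) ≡ len P ∸ toℕ i
  D-to-end {P} P∈𝒫 i = ≤-antisym
    (subst (λ l → D (vtx P i) (endP P) ≤ l ∸ toℕ i) (toℕ-fromℕ (len P))
           (D-along-path (isPath P∈𝒫) (≤fromℕ i)))
    (m≤n+o⇒m∸n≤o (len P) (toℕ i) (begin
      len P                                          ≡⟨ len≡DR P∈𝒫 ⟩
      DR (startP P)                                  ≤⟨ DR-≤ (startP P) (end∈R P∈𝒫) ⟩
      D (startP P) (endP P)                          ≤⟨ D-triangle (startP P) (vtx P i) (endP P) ⟩
      D (startP P) (vtx P i) + D (vtx P i) (endP P)  ≤⟨ +-monoˡ-≤ _ (D-along-path (isPath P∈𝒫) z≤n) ⟩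
      toℕ i + D (vtx P i) (endP P)                   ∎))
    where open ≤-Reasoning

  InPrefix-refl : ∀ {P} (i : Fin (suc (len P))) → InPrefix G R 𝒫 P i i
  InPrefix-refl i = ≤-refl , λ k i≤k k<i → contradiction k<i (≤⇒≯ i≤k)

  InPrefix-extend : ∀ {P} {i i′ j : Fin (suc (len P))} → toℕ i′ ≡ suc (toℕ i) →
    ¬ Anchor (vtx P i) → InPrefix G R 𝒫 P i′ j → InPrefix G R 𝒫 P i j
  InPrefix-extend {P} {i} {i′} {j} i′≡1+i ¬anchor (i′≤j , free) = i≤j , free′
    where
    i≤j : toℕ i ≤ toℕ j
    i≤j = ≤-trans (n≤1+n _) (subst (_≤ toℕ j) i′≡1+i i′≤j)
    free′ : ∀ k → toℕ i ≤ toℕ k → toℕ k < toℕ j → ¬ Anchor (vtx P k)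
    free′ k i≤k k<j with m≤n⇒m<n∨m≡n i≤k
    ... | inj₁ i<k  = free k (subst (_≤ toℕ k) (sym i′≡1+i) i<k) k<j
    ... | inj₂ i≡k  = subst (λ k → ¬ Anchor (vtx P k)) (toℕ-injective i≡k) ¬anchor

  ProfEq-trans : ∀ {x a b c} → ProfEq G R x a b → ProfEq G R x b c → ProfEq G R x a c
  ProfEq-trans a≈b b≈c s s∈R = trans (a≈b s s∈R) (b≈c s s∈R)

  AnchorAhead : (P : Path) → Fin (suc (len P)) → Set
  AnchorAhead P i = ∃[ j ] (InPrefix G R 𝒫 P i j × Anchor (vtx P j) × ProfEq G R (endP P) (vtx P i) (vtx P j))

  -- Between two consecutive anchors there is no milestone, so the profile towards x^P is constant.
  ¬¬-anchorAhead : ∀ {P} → P ∈ 𝒫 → ∀ i → ¬ ¬ AnchorAhead P i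
  ¬¬-anchorAhead {P} P∈𝒫 i = search (len P ∸ toℕ i) i (m+[n∸m]≡n (toℕ≤pred[n] i))
    where
    search : ∀ d i → toℕ i + d ≡ len P → ¬ ¬ AnchorAhead P i
    search zero i i+0≡len = pure (i , InPrefix-refl i , endIsAnchor , λ _ _ → refl)
      where endIsAnchor = inj₂ (P , P∈𝒫 , i , refl , inj₁ (trans (sym (+-identityʳ _)) i+0≡len))
    search (suc d) i i+d≡len = ¬¬-excluded-middle >>= λ where
        (yes anchor) → pure (i , InPrefix-refl i , anchor , λ _ _ → refl)
        (no ¬anchor) → do
          same ← notMilestone ¬anchor
          j , prefix , anchor , same′ ← search d i′ i′+d≡len
          pure (j , InPrefix-extend (toℕ-next i i<len) ¬anchor prefix , anchor , ProfEq-trans same same′)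
      where
      i<len : toℕ i < len P
      i<len = subst (toℕ i <_) i+d≡len (m<m+n (toℕ i) z<s)
      i′ = next i i<len
      i′+d≡len : toℕ i′ + d ≡ len P
      i′+d≡len = trans (cong (_+ d) (toℕ-next i i<len)) (trans (sym (+-suc (toℕ i) d)) i+d≡len)
      notMilestone : ¬ Anchor (vtx P i) → ¬ ¬ ProfEq G R (endP P) (vtx P i) (vtx P i′)
      notMilestone ¬anchor ¬same = ¬anchor (inj₂ (P , P∈𝒫 , i , refl , inj₂ (i′ , toℕ-next i i<len , ¬same)))

  prof≡+D-+D : ∀ x u s → prof G R x u s ≡ + D u s - + D u x
  prof≡+D-+D x u s = cong₂ _⊖∞_ (dist≡fin-D u s) (dist≡fin-D u x)

  sameProfile⇒D-shift : ∀ {x z w s k} → ProfEq G R x z w → s ∈R R →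
    D z x ≡ k + D w x → D z s ≡ D w s + k
  sameProfile⇒D-shift {x} {z} {w} {s} {k} same s∈R Dzx≡k+Dwx = +-cancelʳ-≡ (D w x) _ _ (begin
    D z s + D w x         ≡⟨ +m-+n≡+o-+p⇒m+p≡o+n (D z s) (D z x) (D w s) (D w x) same-at-s ⟩
    D w s + D z x         ≡⟨ cong (λ t → D w s + t) Dzx≡k+Dwx ⟩
    D w s + (k + D w x)   ≡⟨ +-assoc (D w s) k (D w x) ⟨
    D w s + k + D w x     ∎)
    where
    open ≡-Reasoning
    same-at-s : + D z s - + D z x ≡ + D w s - + D w x
    same-at-s = trans (sym (prof≡+D-+D x z s)) (trans (same s s∈R) (prof≡+D-+D x w s))

  D-shift-along-path : ∀ {P} → P ∈ 𝒫 → ∀ {i j s} → toℕ i ≤ toℕ j →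
    ProfEq G R (endP P) (vtx P i) (vtx P j) → s ∈R R → D (vtx P i) s ≡ D (vtx P j) s + (toℕ j ∸ toℕ i)
  D-shift-along-path {P} P∈𝒫 {i} {j} i≤j same s∈R = sameProfile⇒D-shift same s∈R (begin
    D (vtx P i) (endP P)                       ≡⟨ D-to-end P∈𝒫 i ⟩
    len P ∸ toℕ i                              ≡⟨ cong (_∸ toℕ i) (m∸n+n≡m j≤len) ⟨
    len P ∸ toℕ j + toℕ j ∸ toℕ i              ≡⟨ +-∸-assoc (len P ∸ toℕ j) i≤j ⟩
    len P ∸ toℕ j + (toℕ j ∸ toℕ i)            ≡⟨ +-comm (len P ∸ toℕ j) _ ⟩
    toℕ j ∸ toℕ i + (len P ∸ toℕ j)            ≡⟨ cong (λ t → toℕ j ∸ toℕ i + t) (D-to-end P∈𝒫 j) ⟨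
    toℕ j ∸ toℕ i + D (vtx P j) (endP P)       ∎)
    where
    open ≡-Reasoning
    j≤len = toℕ≤pred[n] j

  candidate⇒D≤ : ∀ {u w c} → DistHatCandidate G R 𝒫 u w (fin c) → D u w ≤ c
  candidate⇒D≤ {u} (P , P∈𝒫 , i , j , refl , (i≤j , _) , eq)
    with q , dt≡q , refl ← fin≡+∞fin⇒ (distThrough G U u (vtx P i)) eq = begin
      D u (vtx P j)                            ≤⟨ D-triangle u (vtx P i) (vtx P j) ⟩
      D u (vtx P i) + D (vtx P i) (vtx P j)
        ≤⟨ +-mono-≤ (D-≤-Walk (distThrough⇒Walk dt≡q)) (D-along-path (isPath P∈𝒫) i≤j) ⟩
      q + (toℕ j ∸ toℕ i)                      ∎
    where open ≤-Reasoning

  AnchorOnShortestRoute : Fin n → Fin n → Set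
  AnchorOnShortestRoute u s = ∃[ w ] (Anchor w × ∃[ c ] (DistHatCandidate G R 𝒫 u w (fin c) × c + D w s ≤ D u s))

  anchorOnShortestRoute : ∀ {u s} → U u ≡ true → s ∈R R → ¬ ¬ AnchorOnShortestRoute u s
  anchorOnShortestRoute {u} {s} u∈U s∈R
    with z , t , r , t+r≡D , z∉U , u⇝z , z⇝s ← firstExit (shortestWalk u s) u∈U (R⇒∉U s∈R)
    with P , P∈𝒫 , i , refl ← ∉U⇒onPath z∉U
    with q , q≤t , dt≡q ← distThrough-≤ u⇝z = do
      j , prefix@(i≤j , _) , anchor , same ← ¬¬-anchorAhead P∈𝒫 i
      let w = vtx P j
          candidate = P , P∈𝒫 , i , j , refl , prefix , cong (_+∞ fin (toℕ j ∸ toℕ i)) (sym dt≡q)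
      pure (w , anchor , q + (toℕ j ∸ toℕ i) , candidate , (begin
        q + (toℕ j ∸ toℕ i) + D w s     ≡⟨ +-assoc q _ _ ⟩
        q + (toℕ j ∸ toℕ i + D w s)     ≡⟨ cong (λ t → q + t) (+-comm _ (D w s)) ⟩
        q + (D w s + (toℕ j ∸ toℕ i))   ≡⟨ cong (λ t → q + t) (D-shift-along-path P∈𝒫 i≤j same s∈R) ⟨
        q + D (vtx P i) s               ≤⟨ +-mono-≤ q≤t (D-≤-Walk z⇝s) ⟩
        t + r                           ≡⟨ t+r≡D ⟩
        D u s                           ∎))
    where open ≤-Reasoning

  π : Fin n → Fin n → ℕ → ℤ
  π u w e = + (e + DR w) - + DR u

  cap : ℤ
  cap = + suc ∣ R ∣

  piHat-fin : ∀ {u w} e {b c} → distSet G w R ≡ fin b → distSet G u R ≡ fin c →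
    piHat G R u w (fin e) ≡ (+ (e + b) - + c) ⊓ cap
  piHat-fin e eqw equ rewrite eqw | equ = refl

  piHat≡π⊓cap : ∀ u w e → piHat G R u w (fin e) ≡ π u w e ⊓ cap
  piHat≡π⊓cap u w e = piHat-fin e (distSet≡fin-DR w) (distSet≡fin-DR u)

  π≡π⇒ : ∀ {u₁ u₂ w e₁ e₂} → π u₁ w e₁ ≡ π u₂ w e₂ → e₁ + DR u₂ ≡ e₂ + DR u₁
  π≡π⇒ {u₁} {u₂} {w} {e₁} {e₂} eq = +-cancelʳ-≡ (DR w) _ _ (begin
    e₁ + DR u₂ + DR w   ≡⟨ xy∙z≈xz∙y e₁ (DR u₂) (DR w) ⟩
    e₁ + DR w + DR u₂   ≡⟨ +m-+n≡+o-+p⇒m+p≡o+n (e₁ + DR w) (DR u₁) (e₂ + DR w) (DR u₂) eq ⟩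
    e₂ + DR w + DR u₁   ≡⟨ xy∙z≈xz∙y e₂ (DR w) (DR u₁) ⟩
    e₂ + DR u₁ + DR w   ∎)
    where open ≡-Reasoning

  belowCap⇒candidate : ∀ {u w d v} → IsDistHat G R 𝒫 u w d → piHat G R u w d ≡ v → v ℤ.< cap →
    ∃[ e ] (DistHatCandidate G R 𝒫 u w (fin e) × π u w e ≡ v)
  belowCap⇒candidate {d = ∞}     _                   π̂≡v v<cap = contradiction π̂≡v (ℤₚ.<⇒≢ v<cap ∘ sym)
  belowCap⇒candidate {u} {w} {d = fin e} (_ , inj₂ candidate) π̂≡v v<cap =
    e , candidate , i⊓j≡k∧k<j⇒i≡k (trans (sym (piHat≡π⊓cap u w e)) π̂≡v) v<cap

  boundAtAnchor : ∀ {u₁ u₂ w s e₁ e₂} → s ∈R R → e₂ + D w s ≤ D u₂ s →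
    DistHatCandidate G R 𝒫 u₁ w (fin e₁) → π u₁ w e₁ ≡ π u₂ w e₂ → D u₁ s + DR u₂ ≤ D u₂ s + DR u₁
  boundAtAnchor {u₁} {u₂} {w} {s} {e₁} {e₂} s∈R e₂+Dws≤ candidate π₁≡π₂ = begin
    D u₁ s + DR u₂         ≤⟨ +-monoˡ-≤ (DR u₂) (D-triangle u₁ w s) ⟩
    D u₁ w + D w s + DR u₂ ≤⟨ +-monoˡ-≤ (DR u₂) (+-monoˡ-≤ (D w s) (candidate⇒D≤ candidate)) ⟩
    e₁ + D w s + DR u₂     ≡⟨ xy∙z≈xz∙y e₁ (D w s) (DR u₂) ⟩
    e₁ + DR u₂ + D w s     ≡⟨ cong (_+ D w s) (π≡π⇒ {u₁} {u₂} {w} {e₁} {e₂} π₁≡π₂) ⟩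
    e₂ + DR u₁ + D w s     ≡⟨ xy∙z≈xz∙y e₂ (DR u₁) (D w s) ⟩
    e₂ + D w s + DR u₁     ≤⟨ +-monoˡ-≤ (DR u₁) e₂+Dws≤ ⟩
    D u₂ s + DR u₁         ∎
    where open ≤-Reasoning

  offset : Fin n → Fin n → ℤ
  offset u s = + D u s - + DR u

  prof≡offset-offset : ∀ x u s → prof G R x u s ≡ offset u s - offset u x
  prof≡offset-offset x u s = trans (prof≡+D-+D x u s) (i-j≡[i-k]-[j-k] (+ D u s) (+ D u x) (+ DR u))

  module _ (R-conn : ConnectedSet G R) where

    π<cap : ∀ {u w e s} → s ∈R R → e + D w s ≤ D u s → π u w e ℤ.< cap
    π<cap {u} {w} {e} {s} s∈R e+Dws≤Dus = ℤₚ.≤-<-trans (m≤n+o⇒+m-+n≤+o (e + DR w) (DR u) ∣ R ∣ (begin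
      e + DR w      ≤⟨ +-monoʳ-≤ e (DR-≤ w s∈R) ⟩
      e + D w s     ≤⟨ e+Dws≤Dus ⟩
      D u s         ≤⟨ D-≤-DR+∣R∣ R-conn u s∈R ⟩
      DR u + ∣ R ∣  ∎)) (+<+ (n<1+n _))
      where open ≤-Reasoning

    piHat≡π : ∀ {u w e s} → s ∈R R → e + D w s ≤ D u s → piHat G R u w (fin e) ≡ π u w e
    piHat≡π {u} {w} {e} s∈R e+Dws≤Dus =
      trans (piHat≡π⊓cap u w e) (ℤₚ.i≤j⇒i⊓j≡i (ℤₚ.<⇒≤ (π<cap s∈R e+Dws≤Dus)))

    -- dist^ is only given as a relation; its values exist classically, which is enough for a decidable goal.
    offset-≤ : ∀ {u₁ u₂ s} → U u₂ ≡ true → PiHatEq G R 𝒫 u₁ u₂ → s ∈R R →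
      offset u₁ s ℤ.≤ offset u₂ s
    offset-≤ {u₁} {u₂} {s} u₂∈U π̂≡ s∈R = decidable-stable (offset u₁ s ℤₚ.≤? offset u₂ s) do
      w , anchor , c , candidate₂ , c+Dws≤ ← anchorOnShortestRoute u₂∈U s∈R
      d₂ , min₂ ← ¬¬-∃-IsMinOf (DistHatCandidate G R 𝒫 u₂ w)
      d₁ , min₁ ← ¬¬-∃-IsMinOf (DistHatCandidate G R 𝒫 u₁ w)
      let e₂ , d₂≡e₂ , e₂≤c = IsMinOf-fin min₂ candidate₂
          e₂+Dws≤ = ≤-trans (+-monoˡ-≤ _ e₂≤c) c+Dws≤
          π̂₁≡π₂ = trans (π̂≡ w anchor d₁ d₂ min₁ min₂)
                   (trans (cong (piHat G R u₂ w) d₂≡e₂) (piHat≡π {u₂} {w} {e₂} s∈R e₂+Dws≤))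
          e₁ , candidate₁ , π₁≡π₂ = belowCap⇒candidate min₁ π̂₁≡π₂ (π<cap {u₂} {w} {e₂} s∈R e₂+Dws≤)
      pure (m+p≤o+n⇒+m-+n≤+o-+p (D u₁ s) (DR u₁) (D u₂ s) (DR u₂)
              (boundAtAnchor s∈R e₂+Dws≤ candidate₁ π₁≡π₂))

    offset-≡ : ∀ {u₁ u₂ s} → U u₁ ≡ true → U u₂ ≡ true → PiHatEq G R 𝒫 u₁ u₂ → s ∈R R →
      offset u₁ s ≡ offset u₂ s
    offset-≡ {u₁} {u₂} u₁∈U u₂∈U π̂≡ s∈R = ℤₚ.≤-antisym (offset-≤ u₂∈U π̂≡ s∈R) (offset-≤ u₁∈U π̂≡′ s∈R)
      where
      π̂≡′ : PiHatEq G R 𝒫 u₂ u₁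
      π̂≡′ w anchor d₂ d₁ min₂ min₁ = sym (π̂≡ w anchor d₁ d₂ min₁ min₂)

lemma3p5 : (G : Graph) → IsConnected G →
    (R : Subset (Graph.n G)) → ConnectedSet G R →
    (sR : Fin (Graph.n G)) → sR ∈R R →
    (𝒫 : List (Path {Graph.n G})) → IsRShortestPathCollection G R 𝒫 →
    ∀ u₁ u₂ → inU G 𝒫 u₁ ≡ true → inU G 𝒫 u₂ ≡ true →
    PiHatEq G R 𝒫 u₁ u₂ → ProfEq G R sR u₁ u₂
lemma3p5 G conn R R-conn sR sR∈R 𝒫 coll u₁ u₂ u₁∈U u₂∈U π̂≡ s s∈R = begin
    prof G R sR u₁ s             ≡⟨ prof≡offset-offset sR u₁ s ⟩
    offset u₁ s - offset u₁ sR   ≡⟨ cong₂ _-_ (same-offset s∈R) (same-offset sR∈R) ⟩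
    offset u₂ s - offset u₂ sR   ≡⟨ prof≡offset-offset sR u₂ s ⟨
    prof G R sR u₂ s             ∎
  where
  open ≡-Reasoning
  open ShortestPathCollection G conn R sR∈R 𝒫 coll
  same-offset : ∀ {s} → s ∈R R → offset u₁ s ≡ offset u₂ s
  same-offset = offset-≡ R-conn u₁∈U u₂∈U π̂≡
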